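{- Every tournament has at most one minimal $\tau$-retentive set of size $3$.
   Context: A tournament $T$ consists of a finite vertex set $V(T)$ and an asymmetric, complete binary relation $\succ$ on $V(T)$ ($x$ dominates $y$ if $x\succ y$). For $v\in V(T)$ let $N^-_T(v)=\{u: u\succ v\}$; for $B\subseteq V(T)$, $T[B]$ is the induced subtournament. The tournament equilibrium set $\tau$ is defined recursively: a nonempty $A\subseteq V(T)$ is $\tau$-retentive if for every $x\in A$ with $N^-_T(x)\neq\emptyset$, $\tau(T[N^-_T(x)])\subseteq A$; $A$ is a minimal $\tau$-retentive set if no $\tau$-retentive set of $T$ is a proper subset of $A$; $\tau(T)$ is the union of all minimal $\tau$-retentive sets of $T$. -}

module Defs where

open import Data.Nat using (ℕ; zero; suc)
open import Data.Bool using (Bool; true; false; _∧_)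
open import Data.Fin using (Fin)
open import Data.Fin.Subset using (Subset; _∈_; _⊆_; _⊂_; Nonempty; ⊤)
open import Data.Vec using (lookup; tabulate)
open import Data.Product using (Σ; _×_; ∃)
open import Data.Sum using (_⊎_)
open import Relation.Nullary using (¬_)
open import Data.Empty using (⊥)
open import Relation.Binary.PropositionalEquality using (_≡_; _≢_)

record Tournament (n : ℕ) : Set where
  field
    beats    : Fin n → Fin n → Bool
    complete : ∀ x y → x ≢ y → beats x y ≡ true ⊎ beats y x ≡ true
    asym     : ∀ x y → beats x y ≡ true → beats y x ≡ false

module _ {n : ℕ} (T : Tournament n) where
  open Tournament T

  -- In-neighbourhood of x within the induced subtournament T[B]:
  -- N⁻_{T[B]}(x) = { u ∈ B : u ≻ x }.
  inNbr : Subset n → Fin n → Subset n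
  inNbr B x = tabulate (λ u → lookup B u ∧ beats u x)

  -- τ(T[B]) with fuel k (fuel = recursion depth; k ≥ |B| suffices).
  τ-fuel : ℕ → Subset n → Fin n → Set
  Retentive-fuel : ℕ → Subset n → Subset n → Set
  MinRetentive-fuel : ℕ → Subset n → Subset n → Set

  Retentive-fuel k B A =
    Nonempty A × A ⊆ B ×
    (∀ x → x ∈ A → Nonempty (inNbr B x) →
       ∀ y → τ-fuel k (inNbr B x) y → y ∈ A)

  MinRetentive-fuel k B A =
    Retentive-fuel k B A × (∀ A′ → Retentive-fuel k B A′ → ¬ (A′ ⊂ A))

  τ-fuel zero    B y = ⊥   -- empty (never reached when fuel ≥ |B|)
  τ-fuel (suc k) B y = ∃ λ A → MinRetentive-fuel k B A × y ∈ A

  -- τ-retentive / minimal τ-retentive sets of T[B] (fuel n ≥ |B|).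
  Retentive : Subset n → Subset n → Set
  Retentive B A = Retentive-fuel n B A

  MinRetentive : Subset n → Subset n → Set
  MinRetentive B A = MinRetentive-fuel n B A

  MinimalτRetentive : Subset n → Set
  MinimalτRetentive A = MinRetentive ⊤ A

-- A minimal τ-retentive set A of size 3 is a 3-cycle a ≻ b ≻ c ≻ a: if x ∈ A has dominators,
-- the nonempty set τ(T[N⁻(x)]) supplies one inside A, and an undominated x would on its own be
-- τ-retentive. So every x ∈ A has exactly one dominator p in A, hence τ(T[N⁻(x)]) = {p}; and a
-- vertex forming τ of a tournament on its own is a Condorcet winner there, so p dominates every
-- other dominator of x. Consequently a τ-retentive set meeting A contains its whole cycle, and two
-- distinct such sets are disjoint. For disjoint cycles a ≻ b ≻ c and d ≻ e ≻ f, an edge d ≻ a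
-- forces c ≻ d, then f ≻ c, then b ≻ f, and both orientations of the edge between b and d
-- contradict this. Minimal retentive sets exist only classically, so the argument runs in the
-- double-negation monad, which suffices since equality of subsets is decidable.
module Submission where

open import Defs
open import Level using (0ℓ)
open import Data.Nat using (ℕ; zero; suc; _<_; _≤_; s≤s)
open import Data.Nat.Properties using (suc-injective; n≮0)
open import Data.Nat.Induction using (<-wellFounded)
open import Data.Bool using (true; _∧_)
open import Data.Bool.Properties using (∧-conicalˡ; ∧-conicalʳ) renaming (_≟_ to _≟ᴮ_)
open import Data.Fin using (Fin; zero; suc) renaming (_≟_ to _≟ᶠ_)
open import Data.Fin.Subset
  using (Subset; inside; outside; _∈_; _∉_; _⊆_; _⊂_; _─_; _-_; _∩_; ⁅_⁆; ∣_∣; Nonempty; Empty; ⊤)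
open import Data.Fin.Subset.Properties
open import Data.Vec using (_∷_; here; there; lookup)
open import Data.Vec.Properties using (≡-dec; lookup∘tabulate; []=⇒lookup; lookup⇒[]=)
open import Data.Product using (∃; _×_; _,_; proj₁; proj₂)
open import Data.Sum using (_⊎_; inj₁; inj₂)
open import Data.Empty using (⊥; ⊥-elim)
open import Effect.Monad using (RawMonad)
open import Function using (_∘_; _on_)
open import Induction.WellFounded using (Acc; acc)
open import Relation.Binary.Construct.On using (wellFounded)
open import Relation.Nullary using (¬_; yes; no; contradiction)
open import Relation.Nullary.Decidable using (decidable-stable)
open import Relation.Nullary.Negation using (¬¬-Monad)
open import Relation.Binary.PropositionalEquality
  using (_≡_; _≢_; refl; sym; trans; subst; cong; cong₂; ≢-sym; module ≡-Reasoning)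

open RawMonad (¬¬-Monad {0ℓ})

private variable n : ℕ

x∈p─q⇒x∉q : ∀ (p q : Subset n) {x} → x ∈ p ─ q → x ∉ q
x∈p─q⇒x∉q (_ ∷ p) (_ ∷ q) (there x∈p─q) (there x∈q) = x∈p─q⇒x∉q p q x∈p─q x∈q

x∈p-y⇒x∈p×x≢y : ∀ {p : Subset n} {x y} → x ∈ p - y → x ∈ p × x ≢ y
x∈p-y⇒x∈p×x≢y {p = p} {y = y} x∈p-y =
  p─q⊆p p ⁅ y ⁆ x∈p-y , x∉⁅y⁆⇒x≢y (x∈p─q⇒x∉q p ⁅ y ⁆ x∈p-y)

⁅x⁆⊆p : ∀ {p : Subset n} {x} → x ∈ p → ⁅ x ⁆ ⊆ p
⁅x⁆⊆p {p = p} {x = x} x∈p y∈⁅x⁆ = subst (_∈ p) (sym (x∈⁅y⁆⇒x≡y x y∈⁅x⁆)) x∈p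

∣p∣≡0⇒x∉p : ∀ {p : Subset n} {x} → ∣ p ∣ ≡ 0 → x ∉ p
∣p∣≡0⇒x∉p {p = p} {x = x} ∣p∣≡0 x∈p =
  n≮0 (subst (∣ p - x ∣ <_) ∣p∣≡0 (x∈p⇒∣p-x∣<∣p∣ x∈p))

separated : ∀ {p q : Subset n} → Empty (p ∩ q) → ∀ {x y} → x ∈ p → y ∈ q → x ≢ y
separated p∩q=∅ x∈p y∈q refl = p∩q=∅ (_ , x∈p∩q⁺ (x∈p , y∈q))

∣p∣≡1+m⇒∃x∈p[∣p-x∣≡m] : ∀ {m} (p : Subset n) → ∣ p ∣ ≡ suc m →
                        ∃ λ x → x ∈ p × ∣ p - x ∣ ≡ m
∣p∣≡1+m⇒∃x∈p[∣p-x∣≡m] (inside ∷ p) ∣p∣≡1+m =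
  zero , here , trans (cong ∣_∣ (p─⊥≡p p)) (suc-injective ∣p∣≡1+m)
∣p∣≡1+m⇒∃x∈p[∣p-x∣≡m] (outside ∷ p) ∣p∣≡1+m
  with x , x∈p , ∣p-x∣≡m ← ∣p∣≡1+m⇒∃x∈p[∣p-x∣≡m] p ∣p∣≡1+m = suc x , there x∈p , ∣p-x∣≡m

record Triple (A : Subset n) : Set where
  field
    a b c : Fin n
    a∈A : a ∈ A
    b∈A : b ∈ A
    c∈A : c ∈ A
    a≢b : a ≢ b
    a≢c : a ≢ c
    b≢c : b ≢ c
    cover : ∀ {x} → x ∈ A → x ≡ a ⊎ x ≡ b ⊎ x ≡ c

  swap : Triple A
  swap = record
    { a = b ; b = a ; c = c ; a∈A = b∈A ; b∈A = a∈A ; c∈A = c∈A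
    ; a≢b = ≢-sym a≢b ; a≢c = b≢c ; b≢c = a≢c ; cover = swap-cover ∘ cover }
    where
    swap-cover : ∀ {x} → x ≡ a ⊎ x ≡ b ⊎ x ≡ c → x ≡ b ⊎ x ≡ a ⊎ x ≡ c
    swap-cover (inj₁ x≡a)        = inj₂ (inj₁ x≡a)
    swap-cover (inj₂ (inj₁ x≡b)) = inj₁ x≡b
    swap-cover (inj₂ (inj₂ x≡c)) = inj₂ (inj₂ x≡c)

∣A∣≡3⇒Triple : ∀ {A : Subset n} → ∣ A ∣ ≡ 3 → Triple A
∣A∣≡3⇒Triple {A = A} ∣A∣≡3
  with a , a∈A , ∣A-a∣≡2 ← ∣p∣≡1+m⇒∃x∈p[∣p-x∣≡m] A ∣A∣≡3
  with b , b∈A-a , ∣A-a-b∣≡1 ← ∣p∣≡1+m⇒∃x∈p[∣p-x∣≡m] (A - a) ∣A-a∣≡2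
  with c , c∈A-a-b , ∣A-a-b-c∣≡0 ← ∣p∣≡1+m⇒∃x∈p[∣p-x∣≡m] (A - a - b) ∣A-a-b∣≡1
  with b∈A , b≢a ← x∈p-y⇒x∈p×x≢y b∈A-a
  with c∈A-a , c≢b ← x∈p-y⇒x∈p×x≢y c∈A-a-b
  with c∈A , c≢a ← x∈p-y⇒x∈p×x≢y c∈A-a
  = record
    { a = a ; b = b ; c = c ; a∈A = a∈A ; b∈A = b∈A ; c∈A = c∈A
    ; a≢b = ≢-sym b≢a ; a≢c = ≢-sym c≢a ; b≢c = ≢-sym c≢b ; cover = cover }
  where
  cover : ∀ {x} → x ∈ A → x ≡ a ⊎ x ≡ b ⊎ x ≡ c
  cover {x} x∈A with x ≟ᶠ a | x ≟ᶠ b | x ≟ᶠ c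
  ... | yes x≡a | _       | _       = inj₁ x≡a
  ... | no _    | yes x≡b | _       = inj₂ (inj₁ x≡b)
  ... | no _    | no _    | yes x≡c = inj₂ (inj₂ x≡c)
  ... | no x≢a  | no x≢b  | no x≢c  = ⊥-elim (∣p∣≡0⇒x∉p ∣A-a-b-c∣≡0
    (x∈p∧x≢y⇒x∈p-y (x∈p∧x≢y⇒x∈p-y (x∈p∧x≢y⇒x∈p-y x∈A x≢a) x≢b) x≢c))

module _ {n : ℕ} (T : Tournament n) where
  open Tournament T

  infix 4 _≻_
  _≻_ : Fin n → Fin n → Set
  x ≻ y = beats x y ≡ true

  ≻-asym : ∀ {x y} → x ≻ y → ¬ y ≻ x
  ≻-asym {x} {y} x≻y y≻x = contradiction (trans (sym y≻x) (asym x y x≻y)) λ ()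

  ≻-irrefl : ∀ {x} → ¬ x ≻ x
  ≻-irrefl x≻x = ≻-asym x≻x x≻x

  ∈-inNbr⁻ : ∀ {B x u} → u ∈ inNbr T B x → u ∈ B × u ≻ x
  ∈-inNbr⁻ {B} {x} {u} u∈N⁻x =
    lookup⇒[]= u B (∧-conicalˡ _ _ u∈B∧u≻x) , ∧-conicalʳ _ _ u∈B∧u≻x
    where
    u∈B∧u≻x : lookup B u ∧ beats u x ≡ true
    u∈B∧u≻x = trans (sym (lookup∘tabulate _ u)) ([]=⇒lookup u∈N⁻x)

  ∈-inNbr⁺ : ∀ {B x u} → u ∈ B → u ≻ x → u ∈ inNbr T B x
  ∈-inNbr⁺ {B} {x} {u} u∈B u≻x = lookup⇒[]= u _ (begin
    lookup (inNbr T B x) u  ≡⟨ lookup∘tabulate _ u ⟩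
    lookup B u ∧ beats u x  ≡⟨ cong₂ _∧_ ([]=⇒lookup u∈B) u≻x ⟩
    true                    ∎)
    where open ≡-Reasoning

  τ-fuel⊆ : ∀ k {B y} → τ-fuel T k B y → y ∈ B
  τ-fuel⊆ (suc k) (_ , ((_ , A⊆B , _) , _) , y∈A) = A⊆B y∈A

  minimal-retentive-exists : ∀ {k B A} → Retentive-fuel T k B A → ¬ ¬ ∃ (MinRetentive-fuel T k B)
  minimal-retentive-exists {k} {B} {A} = go (wellFounded ∣_∣ <-wellFounded A)
    where
    go : ∀ {A} → Acc (_<_ on ∣_∣) A → Retentive-fuel T k B A → ¬ ¬ ∃ (MinRetentive-fuel T k B)
    go {A} (acc smaller) A-ret no-min =
      no-min (A , A-ret , λ A′ A′-ret A′⊂A → go (smaller (p⊂q⇒∣p∣<∣q∣ A′⊂A)) A′-ret no-min)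

  τ-nonempty : ∀ k {B} → Nonempty B → ¬ ¬ ∃ (τ-fuel T (suc k) B)
  τ-nonempty k {B} B≠∅ = do
    (A , A-min@(((x , x∈A) , _) , _)) ←
      minimal-retentive-exists (B≠∅ , ⊆-refl , λ _ _ _ _ y∈τ → proj₁ (∈-inNbr⁻ (τ-fuel⊆ k y∈τ)))
    return (x , A , A-min , x∈A)

  τ-singleton⇒condorcet : ∀ k {B c} → (∀ {y} → τ-fuel T (suc (suc k)) B y → y ≡ c) →
                          ∀ {u} → u ∈ B → u ≢ c → c ≻ u
  τ-singleton⇒condorcet k {B} {c} τ≡c {u} u∈B u≢c with complete c u (≢-sym u≢c)
  ... | inj₁ c≻u = c≻u
  ... | inj₂ u≻c = ⊥-elim (self-loop ≻-irrefl)
    where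
    self-loop : ¬ ¬ c ≻ c
    self-loop = do
      (y , A , A-min@((_ , _ , closed) , _) , y∈A) ← τ-nonempty (suc k) (u , u∈B)
      let c∈A = subst (_∈ A) (τ≡c (A , A-min , y∈A)) y∈A
          u∈N⁻c = ∈-inNbr⁺ u∈B u≻c
      (z , z∈τN⁻c) ← τ-nonempty k (u , u∈N⁻c)
      let z∈A = closed c c∈A (u , u∈N⁻c) z z∈τN⁻c
          z≻c = proj₂ (∈-inNbr⁻ {B} (τ-fuel⊆ (suc k) z∈τN⁻c))
      return (subst (_≻ c) (τ≡c (A , A-min , z∈A)) z≻c)

  retentive-⊆-minimal⇒≡ : ∀ {k B A A′} → Retentive-fuel T k B A → MinRetentive-fuel T k B A′ →
                          A ⊆ A′ → A ≡ A′
  retentive-⊆-minimal⇒≡ {A = A} A-ret (_ , minimal) A⊆A′ = ⊆-antisym A⊆A′ λ {x} x∈A′ →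
    decidable-stable (x ∈? A) λ x∉A → minimal _ A-ret (A⊆A′ , x , x∈A′ , x∉A)

  record Cycle (A : Subset n) : Set where
    field
      a b c : Fin n
      a∈A : a ∈ A
      b∈A : b ∈ A
      c∈A : c ∈ A
      a≻b : a ≻ b
      b≻c : b ≻ c
      c≻a : c ≻ a
      cover : ∀ {x} → x ∈ A → x ≡ a ⊎ x ≡ b ⊎ x ≡ c

    rotate : Cycle A
    rotate = record
      { a = b ; b = c ; c = a ; a∈A = b∈A ; b∈A = c∈A ; c∈A = a∈A
      ; a≻b = b≻c ; b≻c = c≻a ; c≻a = a≻b ; cover = rotate-cover ∘ cover }
      where
      rotate-cover : ∀ {x} → x ≡ a ⊎ x ≡ b ⊎ x ≡ c → x ≡ b ⊎ x ≡ c ⊎ x ≡ a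
      rotate-cover (inj₁ x≡a)        = inj₂ (inj₂ x≡a)
      rotate-cover (inj₂ (inj₁ x≡b)) = inj₁ x≡b
      rotate-cover (inj₂ (inj₂ x≡c)) = inj₂ (inj₁ x≡c)

    sole-dominator : ∀ {y} → y ∈ A → y ≻ a → y ≡ c
    sole-dominator y∈A y≻a with cover y∈A
    ... | inj₁ refl        = ⊥-elim (≻-irrefl y≻a)
    ... | inj₂ (inj₁ refl) = ⊥-elim (≻-asym a≻b y≻a)
    ... | inj₂ (inj₂ y≡c)  = y≡c

    ⊆-of-vertices : ∀ {A′} → a ∈ A′ → b ∈ A′ → c ∈ A′ → A ⊆ A′
    ⊆-of-vertices a∈A′ b∈A′ c∈A′ x∈A with cover x∈A
    ... | inj₁ refl        = a∈A′
    ... | inj₂ (inj₁ refl) = b∈A′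
    ... | inj₂ (inj₂ refl) = c∈A′

  open Cycle using (rotate)

  module _ (k : ℕ) (B : Subset n) where

    Ret : Subset n → Set
    Ret = Retentive-fuel T (suc (suc k)) B

    MinRet : Subset n → Set
    MinRet = MinRetentive-fuel T (suc (suc k)) B

    sole-dominator⇒τ-singleton : ∀ {A x p} → Ret A → x ∈ A → p ∈ B → p ≻ x →
                                 (∀ {y} → y ∈ A → y ≻ x → y ≡ p) →
                                 ∀ {y} → τ-fuel T (suc (suc k)) (inNbr T B x) y → y ≡ p
    sole-dominator⇒τ-singleton (_ , _ , closed) x∈A p∈B p≻x sole {y} y∈τ =
      sole (closed _ x∈A (_ , ∈-inNbr⁺ p∈B p≻x) y y∈τ) (proj₂ (∈-inNbr⁻ {B} (τ-fuel⊆ _ y∈τ)))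

    module _ {A : Subset n} (A-ret : Ret A) (C : Cycle A) where
      open Cycle C

      private
        A⊆B : A ⊆ B
        A⊆B = proj₁ (proj₂ A-ret)

      cycle-τ-singleton : ∀ {y} → τ-fuel T (suc (suc k)) (inNbr T B a) y → y ≡ c
      cycle-τ-singleton = sole-dominator⇒τ-singleton A-ret a∈A (A⊆B c∈A) c≻a sole-dominator

      cycle-predecessor-beats : ∀ {u} → u ∈ B → u ≻ a → u ≢ c → c ≻ u
      cycle-predecessor-beats u∈B u≻a =
        τ-singleton⇒condorcet k cycle-τ-singleton (∈-inNbr⁺ u∈B u≻a)

      cycle-predecessor-retained : ∀ {A′} → Ret A′ → a ∈ A′ → ¬ ¬ (c ∈ A′)
      cycle-predecessor-retained {A′} (_ , _ , closed′) a∈A′ = do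
        let c∈N⁻a = ∈-inNbr⁺ (A⊆B c∈A) c≻a
        (y , y∈τ) ← τ-nonempty (suc k) (c , c∈N⁻a)
        return (subst (_∈ A′) (cycle-τ-singleton y∈τ) (closed′ a a∈A′ (c , c∈N⁻a) y y∈τ))

    cycle-⊆-retentive : ∀ {A A′} → Ret A → (C : Cycle A) → Ret A′ → Cycle.a C ∈ A′ → ¬ ¬ (A ⊆ A′)
    cycle-⊆-retentive A-ret C A′-ret a∈A′ = do
      c∈A′ ← cycle-predecessor-retained A-ret C A′-ret a∈A′
      b∈A′ ← cycle-predecessor-retained A-ret (rotate (rotate C)) A′-ret c∈A′
      return λ {x} → Cycle.⊆-of-vertices C a∈A′ b∈A′ c∈A′ {x}

    cycle-meets⇒⊆ : ∀ {A A′ x} → Ret A → Cycle A → Ret A′ → x ∈ A → x ∈ A′ → ¬ ¬ (A ⊆ A′)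
    cycle-meets⇒⊆ A-ret C A′-ret x∈A x∈A′ with Cycle.cover C x∈A
    ... | inj₁ refl        = cycle-⊆-retentive A-ret C A′-ret x∈A′
    ... | inj₂ (inj₁ refl) = cycle-⊆-retentive A-ret (rotate C) A′-ret x∈A′
    ... | inj₂ (inj₂ refl) = cycle-⊆-retentive A-ret (rotate (rotate C)) A′-ret x∈A′

    disjoint-cycles-¬edge : ∀ {A₁ A₂} → Ret A₁ → Ret A₂ → (C₁ : Cycle A₁) (C₂ : Cycle A₂) →
                            (∀ {x y} → x ∈ A₁ → y ∈ A₂ → x ≢ y) → ¬ (Cycle.a C₂ ≻ Cycle.a C₁)
    disjoint-cycles-¬edge R₁@(_ , A₁⊆B , _) R₂@(_ , A₂⊆B , _) C₁ C₂ _≠_ d≻a =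
      both-orientations-fail (complete b d (b∈A₁ ≠ d∈A₂))
      where
      open Cycle C₁ using (a; b; c) renaming (a∈A to a∈A₁; b∈A to b∈A₁; c∈A to c∈A₁)
      open Cycle C₂ using () renaming (a to d; c to f; a∈A to d∈A₂; c∈A to f∈A₂)

      c≻d : c ≻ d
      c≻d = cycle-predecessor-beats R₁ C₁ (A₂⊆B d∈A₂) d≻a (≢-sym (c∈A₁ ≠ d∈A₂))
      f≻c : f ≻ c
      f≻c = cycle-predecessor-beats R₂ C₂ (A₁⊆B c∈A₁) c≻d (c∈A₁ ≠ f∈A₂)
      b≻f : b ≻ f
      b≻f = cycle-predecessor-beats R₁ (rotate (rotate C₁)) (A₂⊆B f∈A₂) f≻c (≢-sym (b∈A₁ ≠ f∈A₂))

      both-orientations-fail : b ≻ d ⊎ d ≻ b → ⊥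
      both-orientations-fail (inj₁ b≻d) =
        ≻-asym b≻f (cycle-predecessor-beats R₂ C₂ (A₁⊆B b∈A₁) b≻d (b∈A₁ ≠ f∈A₂))
      both-orientations-fail (inj₂ d≻b) =
        ≻-asym d≻a (cycle-predecessor-beats R₁ (rotate C₁) (A₂⊆B d∈A₂) d≻b (≢-sym (a∈A₁ ≠ d∈A₂)))

    minimal-dominated : ∀ {A x w} → MinRet A → x ∈ A → w ∈ A → w ≢ x → ¬ ¬ ∃ λ u → u ∈ A × u ≻ x
    minimal-dominated {A} {x} {w} ((_ , A⊆B , closed) , minimal) x∈A w∈A w≢x
      with nonempty? (inNbr T B x)
    ... | yes N⁻x≠∅ = do
      (u , u∈τ) ← τ-nonempty (suc k) N⁻x≠∅
      return (u , closed x x∈A N⁻x≠∅ u u∈τ , proj₂ (∈-inNbr⁻ {B} (τ-fuel⊆ _ u∈τ)))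
    ... | no N⁻x=∅ = contradiction ⁅x⁆⊂A (minimal ⁅ x ⁆ ⁅x⁆-retentive)
      where
      ⁅x⁆-retentive : Ret ⁅ x ⁆
      ⁅x⁆-retentive = (x , x∈⁅x⁆ x) , ⁅x⁆⊆p (A⊆B x∈A) , λ y y∈⁅x⁆ N⁻y≠∅ _ _ →
        contradiction (subst (Nonempty ∘ inNbr T B) (x∈⁅y⁆⇒x≡y x y∈⁅x⁆) N⁻y≠∅) N⁻x=∅
      ⁅x⁆⊂A : ⁅ x ⁆ ⊂ A
      ⁅x⁆⊂A = ⁅x⁆⊆p x∈A , w , w∈A , w≢x ∘ x∈⁅y⁆⇒x≡y x

    minimal-triple-cycle : ∀ {A} → MinRet A → (t : Triple A) → Triple.a t ≻ Triple.b t → ¬ ¬ Cycle A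
    minimal-triple-cycle {A} A-min t a≻b = do
      (u , u∈A , u≻a) ← minimal-dominated A-min a∈A b∈A (≢-sym a≢b)
      let c≻a = dominator-of-a u∈A u≻a
      (v , v∈A , v≻c) ← minimal-dominated A-min c∈A a∈A a≢c
      return (record
        { a = a ; b = b ; c = c ; a∈A = a∈A ; b∈A = b∈A ; c∈A = c∈A
        ; a≻b = a≻b ; b≻c = dominator-of-c c≻a v∈A v≻c ; c≻a = c≻a ; cover = cover })
      where
      open Triple t
      dominator-of-a : ∀ {u} → u ∈ A → u ≻ a → c ≻ a
      dominator-of-a u∈A u≻a with cover u∈A
      ... | inj₁ refl        = ⊥-elim (≻-irrefl u≻a)
      ... | inj₂ (inj₁ refl) = ⊥-elim (≻-asym a≻b u≻a)
      ... | inj₂ (inj₂ refl) = u≻a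
      dominator-of-c : c ≻ a → ∀ {v} → v ∈ A → v ≻ c → b ≻ c
      dominator-of-c c≻a v∈A v≻c with cover v∈A
      ... | inj₁ refl        = ⊥-elim (≻-asym c≻a v≻c)
      ... | inj₂ (inj₁ refl) = v≻c
      ... | inj₂ (inj₂ refl) = ⊥-elim (≻-irrefl v≻c)

    minimal-3-set-cycle : ∀ {A} → MinRet A → ∣ A ∣ ≡ 3 → ¬ ¬ Cycle A
    minimal-3-set-cycle A-min ∣A∣≡3 with t ← ∣A∣≡3⇒Triple ∣A∣≡3
      with complete (Triple.a t) (Triple.b t) (Triple.a≢b t)
    ... | inj₁ a≻b = minimal-triple-cycle A-min t a≻b
    ... | inj₂ b≻a = minimal-triple-cycle A-min (Triple.swap t) b≻a

    disjoint-cycles-impossible : ∀ {A₁ A₂} → Ret A₁ → Ret A₂ → Cycle A₁ → Cycle A₂ →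
                                 ¬ Empty (A₁ ∩ A₂)
    disjoint-cycles-impossible {A₁} {A₂} R₁ R₂ C₁ C₂ A₁∩A₂=∅ =
      one-edge-fails (complete (Cycle.a C₁) (Cycle.a C₂) (apart (Cycle.a∈A C₁) (Cycle.a∈A C₂)))
      where
      apart : ∀ {x y} → x ∈ A₁ → y ∈ A₂ → x ≢ y
      apart = separated A₁∩A₂=∅
      one-edge-fails : Cycle.a C₁ ≻ Cycle.a C₂ ⊎ Cycle.a C₂ ≻ Cycle.a C₁ → ⊥
      one-edge-fails (inj₁ a₁≻a₂) =
        disjoint-cycles-¬edge R₂ R₁ C₂ C₁ (λ y∈A₂ x∈A₁ → ≢-sym (apart x∈A₁ y∈A₂)) a₁≻a₂
      one-edge-fails (inj₂ a₂≻a₁) = disjoint-cycles-¬edge R₁ R₂ C₁ C₂ apart a₂≻a₁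

    minimal-cycles-equal : ∀ {A₁ A₂} → MinRet A₁ → Cycle A₁ → MinRet A₂ → Cycle A₂ → ¬ ¬ (A₁ ≡ A₂)
    minimal-cycles-equal {A₁} {A₂} (R₁ , _) C₁ M₂@(R₂ , _) C₂ with nonempty? (A₁ ∩ A₂)
    ... | yes (x , x∈A₁∩A₂) = do
      A₁⊆A₂ ← cycle-meets⇒⊆ R₁ C₁ R₂ (p∩q⊆p A₁ A₂ x∈A₁∩A₂) (p∩q⊆q A₁ A₂ x∈A₁∩A₂)
      return (retentive-⊆-minimal⇒≡ R₁ M₂ A₁⊆A₂)
    ... | no A₁∩A₂=∅ = ⊥-elim (disjoint-cycles-impossible R₁ R₂ C₁ C₂ A₁∩A₂=∅)

lemma8 : ∀ (n : ℕ) (T : Tournament n) (A₁ A₂ : Subset n)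
           → MinimalτRetentive T A₁ → ∣ A₁ ∣ ≡ 3
           → MinimalτRetentive T A₂ → ∣ A₂ ∣ ≡ 3
           → A₁ ≡ A₂
lemma8 zero T A₁ A₂ _ ∣A₁∣≡3 _ _ = contradiction (subst (_≤ 0) ∣A₁∣≡3 (∣p∣≤n A₁)) λ ()
lemma8 (suc zero) T A₁ A₂ _ ∣A₁∣≡3 _ _ = contradiction (subst (_≤ 1) ∣A₁∣≡3 (∣p∣≤n A₁)) λ { (s≤s ()) }
lemma8 (suc (suc k)) T A₁ A₂ M₁ ∣A₁∣≡3 M₂ ∣A₂∣≡3 = decidable-stable (≡-dec _≟ᴮ_ A₁ A₂) do
  C₁ ← minimal-3-set-cycle T k ⊤ M₁ ∣A₁∣≡3
  C₂ ← minimal-3-set-cycle T k ⊤ M₂ ∣A₂∣≡3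
  minimal-cycles-equal T k ⊤ M₁ C₁ M₂ C₂
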